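{- Let $P$ be a poset and $\mathscr{X}$ a semi-trim $P$-partition of the Stone space $W$. Then the clean interior $\mathscr{X}^o$ is a trim $\widehat P$-partition of $W$ which gives rise to the same trim sets as $\mathscr{X}$, and $\mathscr{X}$ is a regular extension of $\mathscr{X}^o$.
   Context: Let $(P,\le)$ be a poset and $W$ a Stone space (the Stone space of a Boolean ring $R$, whose elements are the compact open subsets of $W$). A $P$-partition of $W$ is a family $\mathscr{X}=\{X_p\mid p\in P\}$ of pairwise disjoint non-empty subsets of $W$ (union need not be $W$). For $Y\subseteq W$, $T(Y)=\{p: Y\cap X_p\neq\emptyset\}$. A compact open set $A$ is $p$-trim ($t(A)=p$) if $T(A)=\{q:q\ge p\}$, trim if $p$-trim for some $p$. $\widehat P=\{p: W$ contains a $p$-trim set$\}$. $\mathscr{X}$ is semi-trim if: every point of $W$ has a neighbourhood base of trim sets; if $A$ is open and $p\in T(A)\cap\widehat P$ then $A$ contains a $p$-trim subset; if $x\in X_p$ then $p=\sup_P\{t(A): A\text{ trim}, x\in A\}$; and for each $p$ every point with a neighbourhood base of $p$-trim sets lies in $X_p$. A point $w\in X_p$ is clean if it has a $p$-trim neighbourhood; a trim partition is a semi-trim one all of whose points are clean. The clean interior of $\mathscr{X}$ is $\mathscr{X}^o=\{Z_q\mid q\in\widehat P\}$, $Z_q$ being the set of clean points of $X_q$. Regular extension: if $P'\subseteq Q$, $\mathscr{U}=\{U_p\mid p\in P'\}$ is a semi-trim $P'$-partition and $\mathscr{V}=\{V_q\mid q\in Q\}$ a semi-trim $Q$-partition of $W$,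 then $\mathscr{V}$ is a regular extension of $\mathscr{U}$ if $U_p\subseteq V_p$ for $p\in P'$ and whenever $A\in R$ is $p$-trim with respect to $\mathscr{U}$ and $A\cap V_q\ne\emptyset$, then $q\ge p$. -}

module Defs where

open import Level using (0ℓ)
open import Data.Bool using (Bool; true; false; _∧_; _xor_)
open import Data.Product using (Σ; ∃; _×_; _,_)
open import Data.Unit using (⊤)
open import Data.Empty using (⊥)
open import Relation.Binary.PropositionalEquality using (_≡_; _≢_)
open import Algebra.Bundles using (RingWithoutOne)

record BooleanRing : Set₁ where
  field
    ring     : RingWithoutOne 0ℓ 0ℓ
  open RingWithoutOne ring public
  field
    *-idem   : ∀ x → (x * x) ≈ x

-- The Stone space of a Boolean ring R: its points are the ring
-- homomorphisms R → 𝔽₂ (= Bool with xor, ∧) which are not identically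
-- zero (equivalently, prime ideals of R).  The compact open subsets are
-- exactly the sets  â = { x | x(a) = 1 }  for a ∈ R, and a ∈ R is
-- identified with â.

module _ (R : BooleanRing) where
  open BooleanRing R

  record Point : Set where
    field
      φ       : Carrier → Bool
      φ-resp  : ∀ {a b} → a ≈ b → φ a ≡ φ b
      φ-+     : ∀ a b → φ (a + b) ≡ (φ a xor φ b)
      φ-*     : ∀ a b → φ (a * b) ≡ (φ a ∧ φ b)
      φ-nz    : ∃ λ a → φ a ≡ true

-- To treat sub-posets (such as P̂) without
-- quotienting, every notion is relative to a poset (P, ≤) and a
-- "domain" predicate D ⊆ P: a D-partition is a family indexed by the
-- elements of D (values of X outside D are ignored), and D carries the
-- induced order.  A P-partition is the case D = everything.

module Theory (R : BooleanRing) {P : Set} (_≤_ : P → P → Set) where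
  open BooleanRing R

  W : Set
  W = Point R

  Subset : Set₁
  Subset = W → Set

  _∈ᴿ_ : W → Carrier → Set
  x ∈ᴿ a = Point.φ x a ≡ true

  _≈W_ : W → W → Set
  x ≈W y = ∀ a → Point.φ x a ≡ Point.φ y a

  Respects : Subset → Set
  Respects S = ∀ x y → x ≈W y → S x → S y

  _⊆ᴿ_ : Carrier → Subset → Set
  a ⊆ᴿ U = ∀ y → y ∈ᴿ a → U y

  IsOpen : Subset → Set
  IsOpen U = ∀ x → U x → ∃ λ a → x ∈ᴿ a × a ⊆ᴿ U

  IsPartition : (P → Set) → (P → Subset) → Set
  IsPartition D X =
      (∀ p → D p → Respects (X p))
    × (∀ p → D p → ∃ λ x → X p x)
    × (∀ p q → D p → D q → p ≢ q → ∀ x → X p x → X q x → ⊥)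

  T : (P → Set) → (P → Subset) → Subset → P → Set
  T D X Y p = D p × ∃ λ x → Y x × X p x

  IsTrim : (P → Set) → (P → Subset) → Carrier → P → Set
  IsTrim D X a p =
      D p
    × (∀ q → T D X (_∈ᴿ a) q → D q × p ≤ q)
    × (∀ q → D q → p ≤ q → T D X (_∈ᴿ a) q)

  Trim : (P → Set) → (P → Subset) → Carrier → Set
  Trim D X a = ∃ λ p → IsTrim D X a p

  Phat : (P → Set) → (P → Subset) → P → Set
  Phat D X p = ∃ λ a → IsTrim D X a p

  NbhdBase : W → (Carrier → Set) → Set₁
  NbhdBase x Good = ∀ U → IsOpen U → U x → ∃ λ a → Good a × x ∈ᴿ a × a ⊆ᴿ U

  IsSup : (P → Set) → (P → Set) → P → Set
  IsSup D S p =
      D p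
    × (∀ q → S q → q ≤ p)
    × (∀ u → D u → (∀ q → S q → q ≤ u) → p ≤ u)

  IsSemiTrim : (P → Set) → (P → Subset) → Set₁
  IsSemiTrim D X =
      IsPartition D X
    × (∀ x → NbhdBase x (Trim D X))
    × (∀ U p → IsOpen U → T D X U p → Phat D X p →
         ∃ λ a → IsTrim D X a p × a ⊆ᴿ U)
    × (∀ x p → D p → X p x →
         IsSup D (λ q → ∃ λ a → IsTrim D X a q × x ∈ᴿ a) p)
    × (∀ p x → D p → NbhdBase x (λ a → IsTrim D X a p) → X p x)

  Clean : (P → Set) → (P → Subset) → P → Subset
  Clean D X p x = X p x × ∃ λ a → IsTrim D X a p × x ∈ᴿ a

  IsTrimPartition : (P → Set) → (P → Subset) → Set₁
  IsTrimPartition D X =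
    IsSemiTrim D X × (∀ p x → D p → X p x → Clean D X p x)

  -- clean interior: the family { Z_q | q ∈ P̂ }, Z_q = clean points of X_q;
  -- its index domain is Phat D X
  CleanInterior : (P → Set) → (P → Subset) → P → Subset
  CleanInterior D X = Clean D X

  IsRegularExtension : (P → Set) → (P → Subset) → (P → Set) → (P → Subset) → Set₁
  IsRegularExtension D' U D V =
      (∀ p → D' p → D p)
    × IsSemiTrim D' U
    × IsSemiTrim D V
    × (∀ p x → D' p → U p x → V p x)
    × (∀ a p q → IsTrim D' U a p → D q → (∃ λ x → x ∈ᴿ a × V q x) → p ≤ q)

  Everything : P → Set
  Everything _ = ⊤

-- A p-trim set A meets X_p, and condition (ii) of semi-trimness shrinks any open set meeting X_p
-- (p ∈ P̂) to a p-trim subset.  Applied inside a trim set this shows that A meets X_p in a clean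
-- point, and that a compact open set meeting X_p meets every X_q with q ≥ p.  Hence A is p-trim
-- for 𝒳 exactly when it is p-trim for 𝒳ᵒ; the only non-trivial inclusion of T-sets combines the
-- neighbourhood base of trim sets with the supremum condition.  The axioms of a trim partition
-- then transfer from 𝒳 to 𝒳ᵒ along this identification of trim sets.
module Submission where

open import Defs
open import Data.Product using (_×_; _,_; proj₁; proj₂; ∃)
open import Data.Unit using (⊤; tt)
open import Data.Empty using (⊥)
open import Relation.Binary.PropositionalEquality as ≡ using (_≡_; _≢_)
open import Relation.Binary.Structures using (IsPreorder; IsPartialOrder)

module CleanInteriorOfSemiTrim
    (R : BooleanRing) {P : Set} {_≤_ : P → P → Set}
    (isPreorder : IsPreorder _≡_ _≤_)
    (X : P → Theory.Subset R _≤_)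
    (X-isSemiTrim : Theory.IsSemiTrim R _≤_ (Theory.Everything R _≤_) X) where

  open Theory R _≤_
  open IsPreorder isPreorder using (trans; refl)

  P̂ : P → Set
  P̂ = Phat Everything X

  Xᵒ : P → Subset
  Xᵒ = CleanInterior Everything X

  X-isPartition : IsPartition Everything X
  X-isPartition = proj₁ X-isSemiTrim

  trimBase : ∀ x → NbhdBase x (Trim Everything X)
  trimBase = proj₁ (proj₂ X-isSemiTrim)

  trimInside : ∀ U p → IsOpen U → T Everything X U p → P̂ p →
               ∃ λ a → IsTrim Everything X a p × a ⊆ᴿ U
  trimInside = proj₁ (proj₂ (proj₂ X-isSemiTrim))

  index-isSupOfTrims : ∀ x p → X p x →
    IsSup Everything (λ q → ∃ λ a → IsTrim Everything X a q × x ∈ᴿ a) p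
  index-isSupOfTrims x p = proj₁ (proj₂ (proj₂ (proj₂ X-isSemiTrim))) x p tt

  trimBase⇒member : ∀ p x → NbhdBase x (λ a → IsTrim Everything X a p) → X p x
  trimBase⇒member p x = proj₂ (proj₂ (proj₂ (proj₂ X-isSemiTrim))) p x tt

  compactOpen-isOpen : ∀ a → IsOpen (_∈ᴿ a)
  compactOpen-isOpen a x x∈a = a , x∈a , λ _ y∈a → y∈a

  W-isOpen : IsOpen (λ _ → ⊤)
  W-isOpen x _ with Point.φ-nz x
  ... | a , x∈a = a , x∈a , λ _ _ → tt

  trim-meets : ∀ {a p} → IsTrim Everything X a p → ∃ λ x → x ∈ᴿ a × X p x
  trim-meets (_ , _ , lower) = proj₂ (lower _ tt refl)

  trim-meets-clean : ∀ {a p} → IsTrim Everything X a p → ∃ λ x → x ∈ᴿ a × Xᵒ p x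
  trim-meets-clean a-trim with trim-meets a-trim
  ... | x , x∈a , Xpx = x , x∈a , Xpx , _ , a-trim , x∈a

  T-upwardClosed : ∀ a {p q} → T Everything X (_∈ᴿ a) p → P̂ p → p ≤ q →
                   T Everything X (_∈ᴿ a) q
  T-upwardClosed a a-meets-p p̂ p≤q
    with trimInside (_∈ᴿ a) _ (compactOpen-isOpen a) a-meets-p p̂
  ... | b , (_ , _ , lower) , b⊆a with lower _ tt p≤q
  ... | _ , y , y∈b , Xqy = tt , y , b⊆a y y∈b , Xqy

  trim⇒trimᵒ : ∀ {a p} → IsTrim Everything X a p → IsTrim P̂ Xᵒ a p
  trim⇒trimᵒ {a} {p} a-trim@(_ , upper , lower) = (a , a-trim) , upperᵒ , lowerᵒ
    where
    upperᵒ : ∀ q → T P̂ Xᵒ (_∈ᴿ a) q → P̂ q × p ≤ q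
    upperᵒ q (q̂ , x , x∈a , Xqx , _) = q̂ , proj₂ (upper q (tt , x , x∈a , Xqx))

    lowerᵒ : ∀ q → P̂ q → p ≤ q → T P̂ Xᵒ (_∈ᴿ a) q
    lowerᵒ q q̂ p≤q with trimInside (_∈ᴿ a) q (compactOpen-isOpen a) (lower q tt p≤q) q̂
    ... | b , b-trim , b⊆a with trim-meets-clean b-trim
    ...   | y , y∈b , Xᵒqy = q̂ , y , b⊆a y y∈b , Xᵒqy

  trimᵒ⇒trim : ∀ {a p} → IsTrim P̂ Xᵒ a p → IsTrim Everything X a p
  trimᵒ⇒trim {a} {p} (p̂ , upperᵒ , lowerᵒ) = tt , upper , lower
    where
    lower : ∀ q → ⊤ → p ≤ q → T Everything X (_∈ᴿ a) q
    lower q _ p≤q with lowerᵒ p p̂ refl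
    ... | _ , x , x∈a , Xpx , _ = T-upwardClosed a (tt , x , x∈a , Xpx) p̂ p≤q

    -- A trim neighbourhood b ⊆ a of x has t(b) ≤ q by the supremum condition at x,
    -- and p ≤ t(b) because b meets the clean part of X_{t(b)} inside a.
    upper : ∀ q → T Everything X (_∈ᴿ a) q → ⊤ × p ≤ q
    upper q (_ , x , x∈a , Xqx) with trimBase x (_∈ᴿ a) (compactOpen-isOpen a) x∈a
    ... | b , (r , b-trim) , x∈b , b⊆a with trim-meets-clean b-trim
    ...   | y , y∈b , Xᵒry =
      tt , trans (proj₂ (upperᵒ r ((b , b-trim) , y , b⊆a y y∈b , Xᵒry)))
                 (proj₁ (proj₂ (index-isSupOfTrims x q Xqx)) r (b , b-trim , x∈b))

  P̂ᵒ⇒P̂ : ∀ {p} → Phat P̂ Xᵒ p → P̂ p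
  P̂ᵒ⇒P̂ (a , a-trimᵒ) = a , trimᵒ⇒trim a-trimᵒ

  Xᵒ-isPartition : IsPartition P̂ Xᵒ
  Xᵒ-isPartition = respects , nonempty , disjoint
    where
    respects : ∀ p → P̂ p → Respects (Xᵒ p)
    respects p _ x y x≈y (Xpx , a , a-trim , x∈a) =
      proj₁ X-isPartition p tt x y x≈y Xpx , a , a-trim , ≡.trans (≡.sym (x≈y a)) x∈a

    nonempty : ∀ p → P̂ p → ∃ λ x → Xᵒ p x
    nonempty p (a , a-trim) = let x , _ , Xᵒpx = trim-meets-clean a-trim in x , Xᵒpx

    disjoint : ∀ p q → P̂ p → P̂ q → p ≢ q → ∀ x → Xᵒ p x → Xᵒ q x → ⊥
    disjoint p q _ _ p≢q x (Xpx , _) (Xqx , _) =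
      proj₂ (proj₂ X-isPartition) p q tt tt p≢q x Xpx Xqx

  Xᵒ-isSemiTrim : IsSemiTrim P̂ Xᵒ
  Xᵒ-isSemiTrim = Xᵒ-isPartition , trimBaseᵒ , trimInsideᵒ , index-isSupOfTrimsᵒ , trimBase⇒memberᵒ
    where
    trimBaseᵒ : ∀ x → NbhdBase x (Trim P̂ Xᵒ)
    trimBaseᵒ x U U-open x∈U with trimBase x U U-open x∈U
    ... | a , (r , a-trim) , x∈a , a⊆U = a , (r , trim⇒trimᵒ a-trim) , x∈a , a⊆U

    trimInsideᵒ : ∀ U p → IsOpen U → T P̂ Xᵒ U p → Phat P̂ Xᵒ p →
                  ∃ λ a → IsTrim P̂ Xᵒ a p × a ⊆ᴿ U
    trimInsideᵒ U p U-open (_ , x , x∈U , Xpx , _) p̂ᵒ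
      with trimInside U p U-open (tt , x , x∈U , Xpx) (P̂ᵒ⇒P̂ p̂ᵒ)
    ... | a , a-trim , a⊆U = a , trim⇒trimᵒ a-trim , a⊆U

    index-isSupOfTrimsᵒ : ∀ x p → P̂ p → Xᵒ p x →
      IsSup P̂ (λ q → ∃ λ a → IsTrim P̂ Xᵒ a q × x ∈ᴿ a) p
    index-isSupOfTrimsᵒ x p p̂ (Xpx , _) with index-isSupOfTrims x p Xpx
    ... | _ , isUpperBound , isLeast =
        p̂
      , (λ q (a , a-trimᵒ , x∈a) → isUpperBound q (a , trimᵒ⇒trim a-trimᵒ , x∈a))
      , λ u _ u-upperBound →
          isLeast u tt λ q (a , a-trim , x∈a) → u-upperBound q (a , trim⇒trimᵒ a-trim , x∈a)

    trimBase⇒memberᵒ : ∀ p x → P̂ p → NbhdBase x (λ a → IsTrim P̂ Xᵒ a p) → Xᵒ p x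
    trimBase⇒memberᵒ p x _ baseᵒ with baseᵒ (λ _ → ⊤) W-isOpen tt
    ... | a , a-trimᵒ , x∈a , _ = trimBase⇒member p x base , a , trimᵒ⇒trim a-trimᵒ , x∈a
      where
      base : NbhdBase x (λ a → IsTrim Everything X a p)
      base U U-open x∈U with baseᵒ U U-open x∈U
      ... | b , b-trimᵒ , x∈b , b⊆U = b , trimᵒ⇒trim b-trimᵒ , x∈b , b⊆U

  Xᵒ-isTrimPartition : IsTrimPartition P̂ Xᵒ
  Xᵒ-isTrimPartition = Xᵒ-isSemiTrim , clean
    where
    clean : ∀ p x → P̂ p → Xᵒ p x → Clean P̂ Xᵒ p x
    clean p x _ Xᵒpx@(_ , a , a-trim , x∈a) = Xᵒpx , a , trim⇒trimᵒ a-trim , x∈a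

  X-isRegularExtension : IsRegularExtension P̂ Xᵒ Everything X
  X-isRegularExtension =
      (λ _ _ → tt) , Xᵒ-isSemiTrim , X-isSemiTrim , (λ _ _ _ → proj₁)
    , λ a p q a-trimᵒ _ (x , x∈a , Xqx) →
        proj₂ (proj₁ (proj₂ (trimᵒ⇒trim a-trimᵒ)) q (tt , x , x∈a , Xqx))

proposition4p7 : (R : BooleanRing) (P : Set) (_≤_ : P → P → Set)
    → IsPartialOrder _≡_ _≤_
    → (X : P → Theory.Subset R _≤_)
    → Theory.IsSemiTrim R _≤_ (Theory.Everything R _≤_) X
    → Theory.IsTrimPartition R _≤_ (Theory.Phat R _≤_ (Theory.Everything R _≤_) X) (Theory.CleanInterior R _≤_ (Theory.Everything R _≤_) X)
      × (∀ a p → (Theory.IsTrim R _≤_ (Theory.Everything R _≤_) X a p → Theory.IsTrim R _≤_ (Theory.Phat R _≤_ (Theory.Everything R _≤_) X) (Theory.CleanInterior R _≤_ (Theory.Everything R _≤_) X) a p)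
               × (Theory.IsTrim R _≤_ (Theory.Phat R _≤_ (Theory.Everything R _≤_) X) (Theory.CleanInterior R _≤_ (Theory.Everything R _≤_) X) a p → Theory.IsTrim R _≤_ (Theory.Everything R _≤_) X a p))
      × Theory.IsRegularExtension R _≤_ (Theory.Phat R _≤_ (Theory.Everything R _≤_) X) (Theory.CleanInterior R _≤_ (Theory.Everything R _≤_) X) (Theory.Everything R _≤_) X
proposition4p7 R P _≤_ isPartialOrder X X-isSemiTrim =
    Xᵒ-isTrimPartition , (λ _ _ → trim⇒trimᵒ , trimᵒ⇒trim) , X-isRegularExtension
  where open CleanInteriorOfSemiTrim R (IsPartialOrder.isPreorder isPartialOrder) X X-isSemiTrim
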